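{- Let $r\ge 2$, $n\ge 1$, $m\ge 0$ be integers and let $0\le c<d\le r-1$. The number of colored permutations in $G_{r,n}$ with exactly $m$ $(c,d)$-descents is $$n!\sum_{j=0}^{n-2m}\binom{m+j}{j}\binom{j}{n-2m-j}r^{2j+2m-n}(-1)^{n-j}.$$
   Context: The colored permutation group $G_{r,n}=\mathbb{Z}_r\wr S_n$ is identified with the set of words $\pi=\pi_1^{[c_1]}\pi_2^{[c_2]}\cdots\pi_n^{[c_n]}$ where $\pi_1\cdots\pi_n$ is a permutation of $\{1,\dots,n\}$ and each color $c_i\in\{0,1,\dots,r-1\}$. Colored letters are totally ordered by $1^{[r-1]}<2^{[r-1]}<\cdots<n^{[r-1]}<\cdots<1^{[1]}<\cdots<n^{[1]}<1^{[0]}<\cdots<n^{[0]}$, i.e. $a^{[i]}<b^{[j]}$ iff $i>j$, or $i=j$ and $a<b$. For colors $c\le d$, $\pi$ has a $(c,d)$-descent at position $i\in\{1,\dots,n-1\}$ if $\pi_i^{[c_i]}>\pi_{i+1}^{[c_{i+1}]}$ in this order, $c_i=c$ and $c_{i+1}=d$. Binomial coefficients with negative lower index are $0$. -}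

module Defs where

open import Data.Nat as ℕ using (ℕ; zero; suc; _∸_; _≤?_; _<?_)
open import Data.Nat.Combinatorics using (_C_)
open import Data.Integer as ℤ using (ℤ; +_; -[1+_])
open import Data.Fin using (Fin; toℕ)
open import Data.Fin.Properties using (_≟_)
open import Data.Vec using (Vec; toList; zip)
open import Data.List using (List; []; _∷_)
open import Data.Product using (Σ; _×_; _,_)
open import Data.Bool using (Bool; true; false; _∧_; _∨_; if_then_else_)
open import Relation.Nullary.Decidable using (True; ⌊_⌋)
import Data.List.Relation.Unary.Unique.DecPropositional as UniqueDec

ColoredLetter : ℕ → ℕ → Set
ColoredLetter n r = Fin n × Fin r

_<ᶜ_ : ∀ {n r} → ColoredLetter n r → ColoredLetter n r → Bool
(a , i) <ᶜ (b , j) = ⌊ toℕ j <? toℕ i ⌋ ∨ (⌊ i ≟ j ⌋ ∧ ⌊ toℕ a <? toℕ b ⌋)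

ColPerm : ℕ → ℕ → Set
ColPerm r n =
  Σ (Vec (Fin n) n × Vec (Fin r) n)
    (λ { (w , cs) → True (UniqueDec.unique? (_≟_ {n}) (toList w)) })

desList : ∀ {n r} → Fin r → Fin r → List (ColoredLetter n r) → ℕ
desList c d [] = 0
desList c d (x ∷ []) = 0
desList c d ((a , ca) ∷ (b , cb) ∷ rest) =
  (if ⌊ ca ≟ c ⌋ ∧ ⌊ cb ≟ d ⌋ ∧ ((b , cb) <ᶜ (a , ca)) then 1 else 0)
    ℕ.+ desList c d ((b , cb) ∷ rest)

des : ∀ {r n} → Fin r → Fin r → ColPerm r n → ℕ
des c d ((w , cs) , _) = desList c d (toList (zip w cs))

sumTo : ℕ → (ℕ → ℤ) → ℤ
sumTo zero f = f 0
sumTo (suc k) f = sumTo k f ℤ.+ f (suc k)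

-- Inside the range the lower
-- index n-2m-j is ≥ 0; the exponent 2j+2m-n is truncated at 0, which only
-- happens when C(j,n-2m-j) = 0 (since then n-2m-j > j).
formula : ℕ → ℕ → ℕ → ℤ
formula r n m = if ⌊ (2 ℕ.* m) ≤? n ⌋ then body else + 0
  where
  body : ℤ
  body =
    + (n ℕ.!) ℤ.* sumTo (n ∸ 2 ℕ.* m) (λ j →
        + ((m ℕ.+ j) C j) ℤ.* + (j C ((n ∸ 2 ℕ.* m) ∸ j))
          ℤ.* (+ r) ℤ.^ ((2 ℕ.* j ℕ.+ 2 ℕ.* m) ∸ n)
          ℤ.* (-[1+ 0 ]) ℤ.^ (n ∸ j))

-- Since c < d, every letter of colour d is smaller than every letter of colour c, so a
-- (c,d)-descent at i just means cᵢ = c and cᵢ₊₁ = d.  The count is therefore n! times the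
-- number a(n, m) of colour words of length n containing the factor cd exactly m times, and
-- classifying words by their first two letters gives
--   a(n+2, m) − r a(n+1, m) + a(n, m) = a(n, m − 1).
-- As (1 − r x + x²)^−(m+1) = Σⱼ C(m+j, j) xʲ (r − x)ʲ, the stated sum is n! times the
-- coefficient of xⁿ in x²ᵐ (1 − r x + x²)^−(m+1), which obeys the same recurrence and has
-- the same initial values.

module Submission where

open import Defs
open import Data.Nat using (ℕ; zero; suc; _∸_; _≤_; _<_; s≤s; _!)
import Data.Nat as ℕ
import Data.Nat.Properties as ℕ
import Data.Fin.Properties as Fin
open import Data.Fin using (Fin; zero; suc; toℕ; punchIn; punchOut)
open import Data.Fin.Properties
  using (_≟_; +↔⊎; *↔×; punchInᵢ≢i; punchIn-injective; punchOut-cong; punchOut-punchIn;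
         punchIn-punchOut)
open import Data.Vec as Vec using (Vec; []; _∷_; toList; zip)
open import Data.Vec.Properties using (toList-map)
open import Data.List using (List; []; _∷_)
open import Data.List.Relation.Unary.All using (All; []; _∷_)
open import Data.List.Relation.Unary.AllPairs as AllPairs using (_∷_)
open import Data.List.Relation.Unary.Unique.Propositional using (Unique)
import Data.List.Relation.Unary.Unique.Propositional.Properties as Unique
import Data.List.Relation.Unary.Unique.DecPropositional as UniqueDec
open import Data.Bool.Properties using (T-irrelevant)
open import Data.Bool using (Bool; true; false; _∧_; _∨_; if_then_else_)
open import Data.Product using (Σ; ∃-syntax; _×_; _,_; proj₁)
open import Data.Sum using (inj₁; inj₂; _⊎_)
open import Data.Sum.Function.Propositional using (_⊎-↔_)
open import Function using (_∘_)
open import Function.Bundles using (_↔_; mk↔ₛ′)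
open import Function.Properties.Inverse using (↔-sym; ↔-trans; ↔-refl)
open import Data.Product.Function.NonDependent.Propositional using (_×-↔_)
open import Relation.Nullary using (¬_; yes; no)
open import Data.Empty using (⊥-elim)
open import Relation.Nullary.Decidable
  using (Dec; ⌊_⌋; True; toWitness; fromWitness; dec-true; dec-false; isYes≗does)
open import Relation.Binary.PropositionalEquality
open import Algebra.Properties.CommutativeMonoid.Sum ℕ.+-0-commutativeMonoid
  using (sum; sum-cong-≗; sum-remove; sum-replicate-zero)

⌊⌋-true : ∀ {A : Set} (a? : Dec A) → A → ⌊ a? ⌋ ≡ true
⌊⌋-true a? a = trans (isYes≗does a?) (dec-true a? a)

⌊⌋-false : ∀ {A : Set} (a? : Dec A) → ¬ A → ⌊ a? ⌋ ≡ false
⌊⌋-false a? ¬a = trans (isYes≗does a?) (dec-false a? ¬a)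

module Counting where

  open import Data.Nat using (_+_; _*_)
  open import Data.Nat.Tactic.RingSolver using (solve-∀)

  Σ-Fin↔ : ∀ {r} {B : Fin r → Set} (f : Fin r → ℕ) → (∀ y → B y ↔ Fin (f y)) →
           Σ (Fin r) B ↔ Fin (sum f)
  Σ-Fin↔ {r = zero} f e = mk↔ₛ′ (λ ()) (λ ()) (λ ()) (λ ())
  Σ-Fin↔ {r = suc r} {B} f e =
    ↔-trans split (↔-trans (e zero ⊎-↔ Σ-Fin↔ (f ∘ suc) (e ∘ suc)) (↔-sym +↔⊎))
    where
    split : Σ (Fin (suc r)) B ↔ (B zero ⊎ Σ (Fin r) (B ∘ suc))
    split = mk↔ₛ′ (λ { (zero , b) → inj₁ b ; (suc i , b) → inj₂ (i , b) })
                  (λ { (inj₁ b) → zero , b ; (inj₂ (i , b)) → suc i , b })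
                  (λ { (inj₁ b) → refl ; (inj₂ (i , b)) → refl })
                  (λ { (zero , b) → refl ; (suc i , b) → refl })

  sum-const : ∀ r k → sum {r} (λ _ → k) ≡ r * k
  sum-const zero k = refl
  sum-const (suc r) k = cong (k +_) (sum-const r k)

  sum-update : ∀ {r} (f g : Fin r → ℕ) (p : Fin r) → (∀ z → z ≢ p → g z ≡ f z) →
               sum g + f p ≡ sum f + g p
  sum-update {suc r} f g p agree = begin
    sum g + f p                         ≡⟨ cong (_+ f p) (sum-remove {i = p} g) ⟩
    g p + sum (g ∘ punchIn p) + f p     ≡⟨ cong (λ s → g p + s + f p) rest ⟩
    g p + sum (f ∘ punchIn p) + f p     ≡⟨ swap (g p) (sum (f ∘ punchIn p)) (f p) ⟩
    f p + sum (f ∘ punchIn p) + g p     ≡⟨ cong (_+ g p) (sym (sum-remove {i = p} f)) ⟩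
    sum f + g p                         ∎
    where
    open ≡-Reasoning
    rest : sum (g ∘ punchIn p) ≡ sum (f ∘ punchIn p)
    rest = sum-cong-≗ (λ z → agree (punchIn p z) (punchInᵢ≢i p z))
    swap : ∀ a s b → a + s + b ≡ b + s + a
    swap = solve-∀

  -- _≡ᵇ_ rather than _≟_, so that suc a ≡ᵇ suc b reduces to a ≡ᵇ b.
  fibreSize : ∀ {r} n → (Vec (Fin r) n → ℕ) → ℕ → ℕ
  fibreSize zero f m = if f [] ℕ.≡ᵇ m then 1 else 0
  fibreSize (suc n) f m = sum (λ y → fibreSize n (f ∘ (y ∷_)) m)

  fibre↔ : ∀ {r} n (f : Vec (Fin r) n → ℕ) m →
           Σ (Vec (Fin r) n) (λ v → f v ≡ m) ↔ Fin (fibreSize n f m)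
  fibre↔ zero f m with f [] ℕ.≡ᵇ m | ℕ.≡ᵇ⇒≡ (f []) m | ℕ.≡⇒≡ᵇ (f []) m
  ... | true  | fm | _  = mk↔ₛ′ (λ _ → zero) (λ _ → [] , fm _) (λ { zero → refl })
                               (λ { ([] , p) → cong ([] ,_) (ℕ.≡-irrelevant (fm _) p) })
  ... | false | _  | ¬fm = mk↔ₛ′ (λ { ([] , p) → ⊥-elim (¬fm p) }) (λ ()) (λ ())
                               (λ { ([] , p) → ⊥-elim (¬fm p) })
  fibre↔ (suc n) f m = ↔-trans split (Σ-Fin↔ _ (λ y → fibre↔ n (f ∘ (y ∷_)) m))
    where
    split : Σ (Vec _ (suc n)) (λ v → f v ≡ m) ↔
            Σ (Fin _) (λ y → Σ (Vec _ n) (λ v → f (y ∷ v) ≡ m))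
    split = mk↔ₛ′ (λ { (y ∷ v , p) → y , v , p }) (λ { (y , v , p) → y ∷ v , p })
                  (λ _ → refl) (λ { (y ∷ v , p) → refl })

  fibreSize-cong : ∀ {r} n {f g : Vec (Fin r) n → ℕ} m → (∀ v → f v ≡ g v) →
                   fibreSize n f m ≡ fibreSize n g m
  fibreSize-cong zero m f≗g = cong (λ x → if x ℕ.≡ᵇ m then 1 else 0) (f≗g [])
  fibreSize-cong (suc n) m f≗g = sum-cong-≗ (λ y → fibreSize-cong n m (f≗g ∘ (y ∷_)))

  fibreSize-suc : ∀ {r} n (f : Vec (Fin r) n → ℕ) m →
                  fibreSize n (suc ∘ f) (suc m) ≡ fibreSize n f m
  fibreSize-suc zero f m = refl
  fibreSize-suc (suc n) f m = sum-cong-≗ (λ y → fibreSize-suc n (f ∘ (y ∷_)) m)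

  fibreSize-suc-zero : ∀ {r} n (f : Vec (Fin r) n → ℕ) → fibreSize n (suc ∘ f) 0 ≡ 0
  fibreSize-suc-zero zero f = refl
  fibreSize-suc-zero {r} (suc n) f =
    trans (sum-cong-≗ (λ y → fibreSize-suc-zero n (f ∘ (y ∷_)))) (sum-replicate-zero r)

open Counting

NoRepeats : ∀ {k n} → Vec (Fin n) k → Set
NoRepeats w = True (UniqueDec.unique? _≟_ (toList w))

Arrangement : ℕ → ℕ → Set
Arrangement k n = Σ (Vec (Fin n) k) NoRepeats

arrangement-≡ : ∀ {k n} {w w′ : Vec (Fin n) k} → w ≡ w′ →
                (u : NoRepeats w) (u′ : NoRepeats w′) → _≡_ {A = Arrangement k n} (w , u) (w′ , u′)
arrangement-≡ refl u u′ = cong (_ ,_) (T-irrelevant u u′)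

module _ {n : ℕ} (x : Fin (suc n)) where

  punchOutAll : ∀ {k} (ws : Vec (Fin (suc n)) k) → All (x ≢_) (toList ws) → Vec (Fin n) k
  punchOutAll [] [] = []
  punchOutAll (w ∷ ws) (x≢w ∷ ps) = punchOut x≢w ∷ punchOutAll ws ps

  punchIn-avoids : ∀ {k} (ws : Vec (Fin n) k) → All (x ≢_) (toList (Vec.map (punchIn x) ws))
  punchIn-avoids [] = []
  punchIn-avoids (w ∷ ws) = (punchInᵢ≢i x w ∘ sym) ∷ punchIn-avoids ws

  punchOutAll-map : ∀ {k} (ws : Vec (Fin n) k) ps → punchOutAll (Vec.map (punchIn x) ws) ps ≡ ws
  punchOutAll-map [] [] = refl
  punchOutAll-map (w ∷ ws) (_ ∷ ps) =
    cong₂ _∷_ (trans (punchOut-cong x refl) (punchOut-punchIn x)) (punchOutAll-map ws ps)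

  map-punchOutAll : ∀ {k} (ws : Vec (Fin (suc n)) k) ps → Vec.map (punchIn x) (punchOutAll ws ps) ≡ ws
  map-punchOutAll [] [] = refl
  map-punchOutAll (w ∷ ws) (x≢w ∷ ps) = cong₂ _∷_ (punchIn-punchOut x≢w) (map-punchOutAll ws ps)

  map-punchIn-unique : ∀ {k} (ws : Vec (Fin n) k) →
                       Unique (toList ws) → Unique (toList (Vec.map (punchIn x) ws))
  map-punchIn-unique ws u =
    subst Unique (sym (toList-map (punchIn x) ws)) (Unique.map⁺ (λ {a} {b} → punchIn-injective x a b) u)

  punchOutAll-unique : ∀ {k} (ws : Vec (Fin (suc n)) k) ps →
                       Unique (toList ws) → Unique (toList (punchOutAll ws ps))
  punchOutAll-unique ws ps u =
    Unique.map⁻ (subst Unique (trans (cong toList (sym (map-punchOutAll ws ps))) (toList-map (punchIn x) _)) u)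

arrangement-suc↔ : ∀ k n → Arrangement (suc k) (suc n) ↔ (Fin (suc n) × Arrangement k n)
arrangement-suc↔ k n = mk↔ₛ′ to from to∘from from∘to
  where
  to : Arrangement (suc k) (suc n) → Fin (suc n) × Arrangement k n
  to (x ∷ ws , u) = x , punchOutAll x ws x∉ws , fromWitness (punchOutAll-unique x ws x∉ws ws-unique)
    where
    x∉ws = AllPairs.head (toWitness u)
    ws-unique = AllPairs.tail (toWitness u)
  from : Fin (suc n) × Arrangement k n → Arrangement (suc k) (suc n)
  from (x , ws , u) =
    x ∷ Vec.map (punchIn x) ws , fromWitness (punchIn-avoids x ws ∷ map-punchIn-unique x ws (toWitness u))
  to∘from : ∀ y → to (from y) ≡ y
  to∘from (x , ws , u) = cong (x ,_) (arrangement-≡ (punchOutAll-map x ws _) _ u)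
  from∘to : ∀ y → from (to y) ≡ y
  from∘to (x ∷ ws , u) = arrangement-≡ (cong (x ∷_) (map-punchOutAll x ws _)) _ u

arrangement↔ : ∀ n → Arrangement n n ↔ Fin (n !)
arrangement↔ zero =
  mk↔ₛ′ (λ _ → zero) (λ _ → [] , _) (λ { zero → refl }) (λ { ([] , _) → refl })
arrangement↔ (suc n) =
  ↔-trans (arrangement-suc↔ n n) (↔-trans (↔-refl ×-↔ arrangement↔ n) (↔-sym *↔×))

module CDFactors {r : ℕ} (c d : Fin r) (c≢d : c ≢ d) where

  open import Data.Nat using (_+_; _*_)

  isCD : Fin r → Fin r → Bool
  isCD x y = ⌊ x ≟ c ⌋ ∧ ⌊ y ≟ d ⌋

  cdFactors : List (Fin r) → ℕ
  cdFactors [] = 0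
  cdFactors (_ ∷ []) = 0
  cdFactors (x ∷ y ∷ l) = (if isCD x y then 1 else 0) + cdFactors (y ∷ l)

  cdWords : ℕ → ℕ → ℕ
  cdWords n = fibreSize n (cdFactors ∘ toList)

  cdWordsAfter : ℕ → Fin r → ℕ → ℕ
  cdWordsAfter n x = fibreSize n (λ v → cdFactors (x ∷ toList v))

  private
    cdFactors-cons-cong : ∀ {x y b} n m → isCD x y ≡ b →
      fibreSize n (λ v → cdFactors (x ∷ y ∷ toList v)) m ≡
      fibreSize n (λ v → (if b then 1 else 0) + cdFactors (y ∷ toList v)) m
    cdFactors-cons-cong {y = y} n m eq =
      fibreSize-cong n m (λ v → cong (λ b → (if b then 1 else 0) + cdFactors (y ∷ toList v)) eq)

  cdWordsAfter-≢c : ∀ {x} n m → x ≢ c → cdWordsAfter (suc n) x m ≡ cdWords (suc n) m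
  cdWordsAfter-≢c {x} n m x≢c =
    sum-cong-≗ {r} (λ y → cdFactors-cons-cong {x} {y} n m
                            (cong (_∧ ⌊ y ≟ d ⌋) (⌊⌋-false (x ≟ c) x≢c)))

  cdWordsAfter-d : ∀ n m → cdWordsAfter n d m ≡ cdWords n m
  cdWordsAfter-d zero m = refl
  cdWordsAfter-d (suc n) m = cdWordsAfter-≢c n m (c≢d ∘ sym)

  cdWordsAfter-c : ∀ n m → cdWordsAfter (suc n) c m + cdWords n m ≡
                   cdWords (suc n) m + fibreSize n (λ v → suc (cdFactors (d ∷ toList v))) m
  cdWordsAfter-c n m = begin
    sum g + cdWords n m         ≡⟨ cong (sum g +_) (sym (cdWordsAfter-d n m)) ⟩
    sum g + f d                 ≡⟨ sum-update f g d g≗f ⟩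
    sum f + g d                 ≡⟨ cong (sum f +_) (cdFactors-cons-cong n m isCD-c-d) ⟩
    cdWords (suc n) m + fibreSize n (λ v → suc (cdFactors (d ∷ toList v))) m ∎
    where
    open ≡-Reasoning
    f g : Fin r → ℕ
    f y = cdWordsAfter n y m
    g y = fibreSize n (λ v → cdFactors (c ∷ y ∷ toList v)) m
    isCD-c : ∀ y → isCD c y ≡ ⌊ y ≟ d ⌋
    isCD-c y = cong (_∧ _) (⌊⌋-true (c ≟ c) refl)
    isCD-c-d : isCD c d ≡ true
    isCD-c-d = trans (isCD-c d) (⌊⌋-true (d ≟ d) refl)
    g≗f : ∀ y → y ≢ d → g y ≡ f y
    g≗f y y≢d = cdFactors-cons-cong n m (trans (isCD-c y) (⌊⌋-false (y ≟ d) y≢d))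

  cdWords-suc-suc : ∀ n m → cdWords (suc (suc n)) m + cdWords (suc n) m ≡
                    r * cdWords (suc n) m + cdWordsAfter (suc n) c m
  cdWords-suc-suc n m = begin
    sum g + cdWords (suc n) m
      ≡⟨ sum-update (λ _ → cdWords (suc n) m) g c (λ y → cdWordsAfter-≢c n m) ⟩
    sum {r} (λ _ → cdWords (suc n) m) + g c ≡⟨ cong (_+ g c) (sum-const r _) ⟩
    r * cdWords (suc n) m + g c            ∎
    where
    open ≡-Reasoning
    g : Fin r → ℕ
    g y = cdWordsAfter (suc n) y m

  private
    +-eliminate : ∀ {x y z u v w} → x + y ≡ z + u → u + v ≡ y + w → x + v ≡ z + w
    +-eliminate {x} {y} {z} {u} {v} {w} xy≡zu uv≡yw = ℕ.+-cancelʳ-≡ y _ _ (begin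
      x + v + y     ≡⟨ ℕ.+-comm (x + v) y ⟩
      y + (x + v)   ≡⟨ ℕ.+-assoc y x v ⟨
      y + x + v     ≡⟨ cong (_+ v) (trans (ℕ.+-comm y x) xy≡zu) ⟩
      z + u + v     ≡⟨ ℕ.+-assoc z u v ⟩
      z + (u + v)   ≡⟨ cong (z +_) (trans uv≡yw (ℕ.+-comm y w)) ⟩
      z + (w + y)   ≡⟨ ℕ.+-assoc z w y ⟨
      z + w + y     ∎)
      where open ≡-Reasoning

  cdWords-rec : ∀ n m → cdWords (suc (suc n)) m + cdWords n m ≡
                r * cdWords (suc n) m + fibreSize n (λ v → suc (cdFactors (d ∷ toList v))) m
  cdWords-rec n m = +-eliminate {y = cdWords (suc n) m} {z = r * cdWords (suc n) m} {u = cdWordsAfter (suc n) c m}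
                      (cdWords-suc-suc n m) (cdWordsAfter-c n m)

  cdWords-rec-zero : ∀ n → cdWords (suc (suc n)) 0 + cdWords n 0 ≡ r * cdWords (suc n) 0
  cdWords-rec-zero n = begin
    cdWords (suc (suc n)) 0 + cdWords n 0                                   ≡⟨ cdWords-rec n 0 ⟩
    r * cdWords (suc n) 0 + fibreSize n (λ v → suc (cdFactors (d ∷ toList v))) 0
      ≡⟨ cong (r * cdWords (suc n) 0 +_) (fibreSize-suc-zero n _) ⟩
    r * cdWords (suc n) 0 + 0                                               ≡⟨ ℕ.+-identityʳ _ ⟩
    r * cdWords (suc n) 0                                                   ∎
    where open ≡-Reasoning

  cdWords-rec-suc : ∀ n m → cdWords (suc (suc n)) (suc m) + cdWords n (suc m) ≡
                            r * cdWords (suc n) (suc m) + cdWords n m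
  cdWords-rec-suc n m = trans (cdWords-rec n (suc m))
    (cong (r * cdWords (suc n) (suc m) +_) (trans (fibreSize-suc n _ m) (cdWordsAfter-d n m)))

module IntegerSequences where

  open import Data.Integer using (ℤ; 0ℤ; _+_; _*_; _-_)
  import Data.Integer.Properties as ℤ
  open import Data.Integer.Tactic.RingSolver using (solve-∀)
  open import Algebra.Properties.AbelianGroup ℤ.+-0-abelianGroup using (∙-cancelʳ)

  sumTo-cong : ∀ k {f g : ℕ → ℤ} → (∀ j → j ≤ k → f j ≡ g j) → sumTo k f ≡ sumTo k g
  sumTo-cong zero f≗g = f≗g 0 ℕ.z≤n
  sumTo-cong (suc k) f≗g =
    cong₂ _+_ (sumTo-cong k (λ j j≤k → f≗g j (ℕ.m≤n⇒m≤1+n j≤k))) (f≗g (suc k) ℕ.≤-refl)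

  sumTo-head : ∀ k (f : ℕ → ℤ) → sumTo (suc k) f ≡ f 0 + sumTo k (f ∘ suc)
  sumTo-head zero f = refl
  sumTo-head (suc k) f = trans (cong (_+ f (suc (suc k))) (sumTo-head k f)) (ℤ.+-assoc (f 0) _ _)

  sumTo-+ : ∀ k (f g : ℕ → ℤ) → sumTo k (λ j → f j + g j) ≡ sumTo k f + sumTo k g
  sumTo-+ zero f g = refl
  sumTo-+ (suc k) f g =
    trans (cong (_+ (f (suc k) + g (suc k))) (sumTo-+ k f g)) (shuffle (sumTo k f) (sumTo k g) _ _)
    where
    shuffle : ∀ a b c e → a + b + (c + e) ≡ a + c + (b + e)
    shuffle = solve-∀

  sumTo-linear : ∀ k a (f g : ℕ → ℤ) → sumTo k (λ j → a * f j - g j) ≡ a * sumTo k f - sumTo k g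
  sumTo-linear zero a f g = refl
  sumTo-linear (suc k) a f g =
    trans (cong (_+ (a * f (suc k) - g (suc k))) (sumTo-linear k a f g)) (collect a (sumTo k f) (sumTo k g) _ _)
    where
    collect : ∀ a s t x y → a * s - t + (a * x - y) ≡ a * (s + x) - (t + y)
    collect = solve-∀

  -- delay t s is the coefficient sequence of xᵗ s(x).
  delay : ℕ → (ℕ → ℤ) → ℕ → ℤ
  delay zero s n = s n
  delay (suc t) s zero = 0ℤ
  delay (suc t) s (suc n) = delay t s n

  delay-+ : ∀ t (s : ℕ → ℤ) k → delay t s (t ℕ.+ k) ≡ s k
  delay-+ zero s k = refl
  delay-+ (suc t) s k = delay-+ t s k

  delay-< : ∀ {t n} (s : ℕ → ℤ) → n < t → delay t s n ≡ 0ℤ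
  delay-< {suc t} {zero} s _ = refl
  delay-< {suc t} {suc n} s (s≤s n<t) = delay-< s n<t

  delay-rec : ∀ ρ (s s′ : ℕ → ℤ) →
    (∀ n → delay 2 s (suc (suc n)) + delay 2 s n ≡ ρ * delay 2 s (suc n) + s′ n) →
    ∀ t n → delay (suc (suc t)) s (suc (suc n)) + delay (suc (suc t)) s n ≡
          ρ * delay (suc (suc t)) s (suc n) + delay t s′ n
  delay-rec ρ s s′ rec zero n = rec n
  delay-rec ρ s s′ rec (suc t) zero = sym (cong (_+ 0ℤ) (ℤ.*-zeroʳ ρ))
  delay-rec ρ s s′ rec (suc t) (suc n) = delay-rec ρ s s′ rec t n

  record Recurrence (ρ : ℤ) (a : ℕ → ℕ → ℤ) : Set where
    field
      at-zero : ∀ n → a (suc (suc n)) 0 + a n 0 ≡ ρ * a (suc n) 0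
      at-suc  : ∀ n m → a (suc (suc n)) (suc m) + a n (suc m) ≡ ρ * a (suc n) (suc m) + a n m

  recurrence-step : ∀ {ρ a b} → Recurrence ρ a → Recurrence ρ b → ∀ {n} →
    (∀ m → a n m ≡ b n m) → (∀ m → a (suc n) m ≡ b (suc n) m) →
    ∀ m → a (suc (suc n)) m ≡ b (suc (suc n)) m
  recurrence-step {ρ} {a} {b} ra rb {n} ih₀ ih₁ m =
    ∙-cancelʳ (a n m) _ _ (trans (step m) (cong (λ x → b (suc (suc n)) m + x) (sym (ih₀ m))))
    where
    open ≡-Reasoning
    open Recurrence
    step : ∀ m → a (suc (suc n)) m + a n m ≡ b (suc (suc n)) m + b n m
    step zero = begin
      a (suc (suc n)) 0 + a n 0   ≡⟨ at-zero ra n ⟩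
      ρ * a (suc n) 0             ≡⟨ cong (ρ *_) (ih₁ 0) ⟩
      ρ * b (suc n) 0             ≡⟨ at-zero rb n ⟨
      b (suc (suc n)) 0 + b n 0   ∎
    step (suc m) = begin
      a (suc (suc n)) (suc m) + a n (suc m)   ≡⟨ at-suc ra n m ⟩
      ρ * a (suc n) (suc m) + a n m           ≡⟨ cong₂ (λ x y → ρ * x + y) (ih₁ (suc m)) (ih₀ m) ⟩
      ρ * b (suc n) (suc m) + b n m           ≡⟨ at-suc rb n m ⟨
      b (suc (suc n)) (suc m) + b n (suc m)   ∎

  recurrence-unique : ∀ {ρ a b} → Recurrence ρ a → Recurrence ρ b →
    (∀ m → a 0 m ≡ b 0 m) → (∀ m → a 1 m ≡ b 1 m) → ∀ n m → a n m ≡ b n m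
  recurrence-unique {ρ} {a} {b} ra rb a₀≡b₀ a₁≡b₁ n = proj₁ (consecutive n)
    where
    consecutive : ∀ n → (∀ m → a n m ≡ b n m) × (∀ m → a (suc n) m ≡ b (suc n) m)
    consecutive zero = a₀≡b₀ , a₁≡b₁
    consecutive (suc n) with consecutive n
    ... | ih₀ , ih₁ = ih₁ , recurrence-step ra rb ih₀ ih₁

open IntegerSequences

module ClosedForm (r : ℕ) where

  open import Data.Integer using (ℤ; +_; 0ℤ; 1ℤ; -1ℤ; _+_; _*_; _-_; _^_)
  import Data.Integer.Properties as ℤ
  open import Data.Integer.Tactic.RingSolver using (solve-∀)
  open import Data.Nat.Combinatorics using (_C_; nCk+nC[k+1]≡[n+1]C[k+1]; k>n⇒nCk≡0; nCn≡1)
  open import Algebra.Properties.CommutativeSemigroup ℤ.*-commutativeSemigroup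
    using () renaming (x∙yz≈y∙xz to *-leftComm)

  ρ : ℤ
  ρ = + r

  -- coeff j i is the coefficient of xⁱ in (r − x)ʲ.
  coeff : ℕ → ℕ → ℤ
  coeff j i = + (j C i) * ρ ^ (j ∸ i) * -1ℤ ^ i

  coeff-suc-zero : ∀ j → coeff (suc j) 0 ≡ ρ * coeff j 0
  coeff-suc-zero j = lemma ρ (ρ ^ j)
    where
    lemma : ∀ ρ x → 1ℤ * (ρ * x) * 1ℤ ≡ ρ * (1ℤ * x * 1ℤ)
    lemma = solve-∀

  C-suc-pow-shift : ∀ j i → + (j C suc i) * ρ ^ (j ∸ i) ≡ ρ * (+ (j C suc i) * ρ ^ (j ∸ suc i))
  C-suc-pow-shift j i with i ℕ.<? j
  ... | yes i<j rewrite ℕ.+-∸-assoc 1 i<j = *-leftComm (+ (j C suc i)) ρ (ρ ^ (j ∸ suc i))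
  ... | no i≮j rewrite k>n⇒nCk≡0 (s≤s (ℕ.≮⇒≥ i≮j)) =
    trans (ℤ.*-zeroˡ (ρ ^ (j ∸ i)))
          (sym (trans (cong (ρ *_) (ℤ.*-zeroˡ (ρ ^ (j ∸ suc i)))) (ℤ.*-zeroʳ ρ)))

  coeff-suc-suc : ∀ j i → coeff (suc j) (suc i) ≡ ρ * coeff j (suc i) - coeff j i
  coeff-suc-suc j i = begin
    + (suc j C suc i) * ρ ^ (j ∸ i) * -1ℤ ^ suc i
      ≡⟨ cong (λ t → t * ρ ^ (j ∸ i) * -1ℤ ^ suc i)
              (trans (cong +_ (sym (nCk+nC[k+1]≡[n+1]C[k+1] j i))) (ℤ.pos-+ (j C i) (j C suc i))) ⟩
    (+ (j C i) + + (j C suc i)) * ρ ^ (j ∸ i) * -1ℤ ^ suc i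
      ≡⟨ split (+ (j C i)) (+ (j C suc i)) (ρ ^ (j ∸ i)) (-1ℤ ^ i) ⟩
    + (j C suc i) * ρ ^ (j ∸ i) * -1ℤ ^ suc i - coeff j i
      ≡⟨ cong (λ t → t * -1ℤ ^ suc i - coeff j i) (C-suc-pow-shift j i) ⟩
    ρ * (+ (j C suc i) * ρ ^ (j ∸ suc i)) * -1ℤ ^ suc i - coeff j i
      ≡⟨ cong (_- coeff j i) (ℤ.*-assoc ρ _ _) ⟩
    ρ * coeff j (suc i) - coeff j i ∎
    where
    open ≡-Reasoning
    split : ∀ a b x s → (a + b) * x * (-1ℤ * s) ≡ b * x * (-1ℤ * s) - a * x * s
    split = solve-∀

  -- series w k is the coefficient of xᵏ in Σⱼ w j xʲ (r − x)ʲ,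
  -- and series⁺ w k that of Σⱼ w j xʲ (r − x)ʲ⁺¹.
  series series⁺ : (ℕ → ℤ) → ℕ → ℤ
  series w k = sumTo k (λ j → w j * coeff j (k ∸ j))
  series⁺ w k = sumTo k (λ j → w j * coeff (suc j) (k ∸ j))

  series⁺-zero : ∀ w → series⁺ w 0 ≡ ρ * series w 0
  series⁺-zero w = trans (cong (w 0 *_) (coeff-suc-zero 0)) (*-leftComm (w 0) ρ _)

  series⁺-suc : ∀ w k → series⁺ w (suc k) ≡ ρ * series w (suc k) - series w k
  series⁺-suc w k = begin
    sumTo k (λ j → w j * coeff (suc j) (suc k ∸ j)) + w (suc k) * coeff (suc (suc k)) (k ∸ k)
      ≡⟨ cong₂ _+_ (sumTo-cong k inner) last ⟩
    sumTo k (λ j → ρ * a j - b j) + ρ * ℓ     ≡⟨ cong (_+ ρ * ℓ) (sumTo-linear k ρ a b) ⟩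
    ρ * sumTo k a - sumTo k b + ρ * ℓ         ≡⟨ collect ρ (sumTo k a) (sumTo k b) ℓ ⟩
    ρ * series w (suc k) - series w k         ∎
    where
    open ≡-Reasoning
    a b : ℕ → ℤ
    a j = w j * coeff j (suc k ∸ j)
    b j = w j * coeff j (k ∸ j)
    ℓ : ℤ
    ℓ = w (suc k) * coeff (suc k) (k ∸ k)
    collect : ∀ ρ s t x → ρ * s - t + ρ * x ≡ ρ * (s + x) - t
    collect = solve-∀
    distrib : ∀ ρ w x y → w * (ρ * x - y) ≡ ρ * (w * x) - w * y
    distrib = solve-∀
    inner : ∀ j → j ≤ k → w j * coeff (suc j) (suc k ∸ j) ≡ ρ * a j - b j
    inner j j≤k rewrite ℕ.+-∸-assoc 1 j≤k =
      trans (cong (w j *_) (coeff-suc-suc j (k ∸ j))) (distrib ρ (w j) _ _)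
    last : w (suc k) * coeff (suc (suc k)) (k ∸ k) ≡ ρ * ℓ
    last rewrite ℕ.n∸n≡0 k =
      trans (cong (w (suc k) *_) (coeff-suc-zero (suc k))) (*-leftComm (w (suc k)) ρ _)

  series-suc : ∀ w k → series w (suc k) ≡ sumTo k (λ j → w (suc j) * coeff (suc j) (k ∸ j))
  series-suc w k = begin
    series w (suc k)                 ≡⟨ sumTo-head k _ ⟩
    w 0 * coeff 0 (suc k) + rest     ≡⟨ cong (_+ rest) (ℤ.*-zeroʳ (w 0)) ⟩
    0ℤ + rest                        ≡⟨ ℤ.+-identityˡ rest ⟩
    rest                             ∎
    where
    open ≡-Reasoning
    rest : ℤ
    rest = sumTo k (λ j → w (suc j) * coeff (suc j) (k ∸ j))

  weight : ℕ → ℕ → ℤ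
  weight m j = + ((m ℕ.+ j) C j)

  weight-pascal : ∀ m j → weight (suc m) (suc j) ≡ weight m (suc j) + weight (suc m) j
  weight-pascal m j = begin
    + (suc N C suc j)               ≡⟨ cong +_ (nCk+nC[k+1]≡[n+1]C[k+1] N j) ⟨
    + (N C j ℕ.+ N C suc j)         ≡⟨ cong +_ (ℕ.+-comm (N C j) _) ⟩
    + (N C suc j ℕ.+ N C j)         ≡⟨ ℤ.pos-+ (N C suc j) _ ⟩
    weight m (suc j) + + (N C j)    ≡⟨ cong (λ n → weight m (suc j) + + (n C j)) (ℕ.+-suc m j) ⟩
    weight m (suc j) + weight (suc m) j ∎
    where
    open ≡-Reasoning
    N = m ℕ.+ suc j

  weight-zero : ∀ j → weight 0 j ≡ 1ℤ
  weight-zero j = cong +_ (nCn≡1 j)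

  series-weight-suc : ∀ m k → series (weight (suc m)) (suc k) ≡
                              series (weight m) (suc k) + series⁺ (weight (suc m)) k
  series-weight-suc m k = begin
    series (weight (suc m)) (suc k)
      ≡⟨ series-suc (weight (suc m)) k ⟩
    sumTo k (λ j → weight (suc m) (suc j) * coeff (suc j) (k ∸ j))
      ≡⟨ sumTo-cong k (λ j _ → pascal-term j) ⟩
    sumTo k (λ j → weight m (suc j) * coeff (suc j) (k ∸ j) + weight (suc m) j * coeff (suc j) (k ∸ j))
      ≡⟨ sumTo-+ k _ _ ⟩
    sumTo k (λ j → weight m (suc j) * coeff (suc j) (k ∸ j)) + series⁺ (weight (suc m)) k
      ≡⟨ cong (_+ series⁺ (weight (suc m)) k) (series-suc (weight m) k) ⟨
    series (weight m) (suc k) + series⁺ (weight (suc m)) k ∎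
    where
    open ≡-Reasoning
    pascal-term : ∀ j → weight (suc m) (suc j) * coeff (suc j) (k ∸ j) ≡
                        weight m (suc j) * coeff (suc j) (k ∸ j) + weight (suc m) j * coeff (suc j) (k ∸ j)
    pascal-term j = trans (cong (_* coeff (suc j) (k ∸ j)) (weight-pascal m j))
                          (ℤ.*-distribʳ-+ (coeff (suc j) (k ∸ j)) (weight m (suc j)) (weight (suc m) j))

  series-weight-zero : ∀ k → series (weight 0) (suc k) ≡ series⁺ (weight 0) k
  series-weight-zero k =
    trans (series-suc (weight 0) k)
          (sumTo-cong k (λ j _ → cong (_* coeff (suc j) (k ∸ j))
                                      (trans (weight-zero (suc j)) (sym (weight-zero j)))))

  series-rec-zero : ∀ k → series (weight 0) (suc (suc k)) + series (weight 0) k ≡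
                          ρ * series (weight 0) (suc k)
  series-rec-zero k = begin
    series (weight 0) (suc (suc k)) + series (weight 0) k
      ≡⟨ cong (_+ series (weight 0) k) (trans (series-weight-zero (suc k)) (series⁺-suc (weight 0) k)) ⟩
    ρ * series (weight 0) (suc k) - series (weight 0) k + series (weight 0) k
      ≡⟨ cancel _ _ ⟩
    ρ * series (weight 0) (suc k) ∎
    where
    open ≡-Reasoning
    cancel : ∀ a b → a - b + b ≡ a
    cancel = solve-∀

  series-rec-suc : ∀ m k → series (weight (suc m)) (suc (suc k)) + series (weight (suc m)) k ≡
                           ρ * series (weight (suc m)) (suc k) + series (weight m) (suc (suc k))
  series-rec-suc m k = begin
    series (weight (suc m)) (suc (suc k)) + series (weight (suc m)) k
      ≡⟨ cong (_+ series (weight (suc m)) k) (trans (series-weight-suc m (suc k))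
                (cong (λ x → series (weight m) (suc (suc k)) + x) (series⁺-suc (weight (suc m)) k))) ⟩
    series (weight m) (suc (suc k)) + (ρ * s (suc k) - s k) + s k
      ≡⟨ cancel (series (weight m) (suc (suc k))) (ρ * s (suc k)) (s k) ⟩
    ρ * series (weight (suc m)) (suc k) + series (weight m) (suc (suc k)) ∎
    where
    open ≡-Reasoning
    s : ℕ → ℤ
    s = series (weight (suc m))
    cancel : ∀ p a b → p + (a - b) + b ≡ a + p
    cancel = solve-∀

  series-rec-suc-delayed : ∀ m n →
    delay 2 (series (weight (suc m))) (suc (suc n)) + delay 2 (series (weight (suc m))) n ≡
    ρ * delay 2 (series (weight (suc m))) (suc n) + series (weight m) n
  series-rec-suc-delayed m zero = sym (cong (_+ 1ℤ) (ℤ.*-zeroʳ ρ))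
  series-rec-suc-delayed m (suc zero) = begin
    series (weight (suc m)) 1 + 0ℤ
      ≡⟨ cong (_+ 0ℤ) (series-weight-suc m 0) ⟩
    series (weight m) 1 + series⁺ (weight (suc m)) 0 + 0ℤ
      ≡⟨ cong (λ x → series (weight m) 1 + x + 0ℤ) (series⁺-zero (weight (suc m))) ⟩
    series (weight m) 1 + ρ * 1ℤ + 0ℤ
      ≡⟨ swap (series (weight m) 1) (ρ * 1ℤ) ⟩
    ρ * 1ℤ + series (weight m) 1 ∎
    where
    open ≡-Reasoning
    swap : ∀ a b → a + b + 0ℤ ≡ b + a
    swap = solve-∀
  series-rec-suc-delayed m (suc (suc k)) = series-rec-suc m k

  closed : ℕ → ℕ → ℤ
  closed n m = delay (2 ℕ.* m) (series (weight m)) n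

  closed-suc : ∀ n m → closed n (suc m) ≡ delay (suc (suc (2 ℕ.* m))) (series (weight (suc m))) n
  closed-suc n m = cong (λ t → delay t (series (weight (suc m))) n) (ℕ.*-suc 2 m)

  closed-recurrence : Recurrence ρ closed
  closed-recurrence = record { at-zero = series-rec-zero ; at-suc = at-suc }
    where
    at-suc : ∀ n m → closed (suc (suc n)) (suc m) + closed n (suc m) ≡
                     ρ * closed (suc n) (suc m) + closed n m
    at-suc n m rewrite closed-suc (suc (suc n)) m | closed-suc (suc n) m | closed-suc n m =
      delay-rec ρ _ _ (series-rec-suc-delayed m) (2 ℕ.* m) n

  sign-even : ∀ m x → -1ℤ ^ (2 ℕ.* m ℕ.+ x) ≡ -1ℤ ^ x
  sign-even m x = begin
    -1ℤ ^ (2 ℕ.* m ℕ.+ x)          ≡⟨ ℤ.^-distribˡ-+-* -1ℤ (2 ℕ.* m) x ⟩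
    -1ℤ ^ (2 ℕ.* m) * -1ℤ ^ x      ≡⟨ cong (_* -1ℤ ^ x) (ℤ.^-*-assoc -1ℤ 2 m) ⟨
    (-1ℤ ^ 2) ^ m * -1ℤ ^ x        ≡⟨ cong (_* -1ℤ ^ x) (ℤ.^-zeroˡ m) ⟩
    1ℤ * -1ℤ ^ x                   ≡⟨ ℤ.*-identityˡ _ ⟩
    -1ℤ ^ x                        ∎
    where open ≡-Reasoning

  double-∸ : ∀ {j k} m → j ≤ k → (2 ℕ.* j ℕ.+ 2 ℕ.* m) ∸ (2 ℕ.* m ℕ.+ k) ≡ j ∸ (k ∸ j)
  double-∸ {j} {k} m j≤k = begin
    (2 ℕ.* j ℕ.+ 2 ℕ.* m) ∸ (2 ℕ.* m ℕ.+ k)   ≡⟨ cong (_∸ (2 ℕ.* m ℕ.+ k)) (ℕ.+-comm (2 ℕ.* j) _) ⟩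
    (2 ℕ.* m ℕ.+ 2 ℕ.* j) ∸ (2 ℕ.* m ℕ.+ k)   ≡⟨ ℕ.[m+n]∸[m+o]≡n∸o (2 ℕ.* m) _ _ ⟩
    (j ℕ.+ j′) ∸ k                            ≡⟨ cong ((j ℕ.+ j′) ∸_) (ℕ.m+[n∸m]≡n j≤k) ⟨
    (j ℕ.+ j′) ∸ (j ℕ.+ (k ∸ j))              ≡⟨ ℕ.[m+n]∸[m+o]≡n∸o j _ _ ⟩
    j′ ∸ (k ∸ j)                              ≡⟨ cong (_∸ (k ∸ j)) (ℕ.+-identityʳ j) ⟩
    j ∸ (k ∸ j)                               ∎
    where
    open ≡-Reasoning
    j′ = j ℕ.+ 0

  formulaTerm : ℕ → ℕ → ℕ → ℤ
  formulaTerm n m j =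
    + ((m ℕ.+ j) C j) * + (j C ((n ∸ 2 ℕ.* m) ∸ j))
      * ρ ^ ((2 ℕ.* j ℕ.+ 2 ℕ.* m) ∸ n) * -1ℤ ^ (n ∸ j)

  formulaTerm-weight : ∀ m {j k} → j ≤ k →
                       formulaTerm (2 ℕ.* m ℕ.+ k) m j ≡ weight m j * coeff j (k ∸ j)
  formulaTerm-weight m {j} {k} j≤k = begin
    formulaTerm (2 ℕ.* m ℕ.+ k) m j
      ≡⟨ cong₂ (λ i e → weight m j * + (j C (i ∸ j)) * ρ ^ e * -1ℤ ^ ((2 ℕ.* m ℕ.+ k) ∸ j))
               (ℕ.m+n∸m≡n (2 ℕ.* m) k) (double-∸ m j≤k) ⟩
    weight m j * + (j C (k ∸ j)) * ρ ^ (j ∸ (k ∸ j)) * -1ℤ ^ ((2 ℕ.* m ℕ.+ k) ∸ j)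
      ≡⟨ cong (weight m j * + (j C (k ∸ j)) * ρ ^ (j ∸ (k ∸ j)) *_)
              (trans (cong (-1ℤ ^_) (ℕ.+-∸-assoc (2 ℕ.* m) j≤k)) (sign-even m (k ∸ j))) ⟩
    weight m j * + (j C (k ∸ j)) * ρ ^ (j ∸ (k ∸ j)) * -1ℤ ^ (k ∸ j)
      ≡⟨ reassoc (weight m j) _ _ _ ⟩
    weight m j * coeff j (k ∸ j) ∎
    where
    open ≡-Reasoning
    reassoc : ∀ a b x s → a * b * x * s ≡ a * (b * x * s)
    reassoc = solve-∀

  formulaSum : ℕ → ℕ → ℤ
  formulaSum n m = + (n !) * sumTo (n ∸ 2 ℕ.* m) (formulaTerm n m)

  formula-≤ : ∀ {n m} → 2 ℕ.* m ≤ n → formula r n m ≡ formulaSum n m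
  formula-≤ {n} {m} 2m≤n =
    cong (if_then formulaSum n m else 0ℤ) (⌊⌋-true (2 ℕ.* m ℕ.≤? n) 2m≤n)

  formula-≰ : ∀ {n m} → ¬ 2 ℕ.* m ≤ n → formula r n m ≡ 0ℤ
  formula-≰ {n} {m} 2m≰n =
    cong (if_then formulaSum n m else 0ℤ) (⌊⌋-false (2 ℕ.* m ℕ.≤? n) 2m≰n)

  formula≡closed : ∀ n m → formula r n m ≡ + (n !) * closed n m
  formula≡closed n m with ℕ.≤-<-connex (2 ℕ.* m) n
  ... | inj₂ n<2m = begin
    formula r n m               ≡⟨ formula-≰ {m = m} (ℕ.<⇒≱ n<2m) ⟩
    0ℤ                          ≡⟨ ℤ.*-zeroʳ (+ (n !)) ⟨
    + (n !) * 0ℤ                ≡⟨ cong (+ (n !) *_) (delay-< _ n<2m) ⟨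
    + (n !) * closed n m        ∎
    where open ≡-Reasoning
  ... | inj₁ 2m≤n with ℕ.m≤n⇒∃[o]m+o≡n 2m≤n
  ... | k , refl = begin
    formula r n m                                        ≡⟨ formula-≤ {m = m} 2m≤n ⟩
    formulaSum n m
      ≡⟨ cong (λ i → + (n !) * sumTo i (formulaTerm n m)) (ℕ.m+n∸m≡n (2 ℕ.* m) k) ⟩
    + (n !) * sumTo k (formulaTerm n m)
      ≡⟨ cong (+ (n !) *_) (sumTo-cong k (λ j → formulaTerm-weight m)) ⟩
    + (n !) * series (weight m) k                        ≡⟨ cong (+ (n !) *_) (delay-+ (2 ℕ.* m) _ k) ⟨
    + (n !) * closed n m                                 ∎
    where open ≡-Reasoning

module WordCount {r : ℕ} (c d : Fin r) (c≢d : c ≢ d) where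

  open import Data.Integer using (+_; _+_; _*_)
  import Data.Integer.Properties as ℤ
  open CDFactors c d c≢d
  open ClosedForm r

  private
    pos-+≡ : ∀ a b {c} → a ℕ.+ b ≡ c → + a + + b ≡ + c
    pos-+≡ a b eq = trans (sym (ℤ.pos-+ a b)) (cong +_ eq)

  cdWords-recurrence : Recurrence (+ r) (λ n m → + cdWords n m)
  cdWords-recurrence = record
    { at-zero = λ n → trans (pos-+≡ (cdWords (suc (suc n)) 0) (cdWords n 0) (cdWords-rec-zero n))
                            (ℤ.pos-* r _)
    ; at-suc  = λ n m → trans (pos-+≡ (cdWords (suc (suc n)) (suc m)) (cdWords n (suc m)) (cdWords-rec-suc n m))
                              (trans (ℤ.pos-+ (r ℕ.* cdWords (suc n) (suc m)) _)
                                     (cong (_+ + cdWords n m) (ℤ.pos-* r _)))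
    }

  cdWords-one : ∀ m → + cdWords 1 m ≡ closed 1 m
  cdWords-one zero = begin
    + sum {r} (λ _ → 1)               ≡⟨ cong +_ (trans (sum-const r 1) (ℕ.*-identityʳ r)) ⟩
    ρ                                 ≡⟨ ℤ.*-identityʳ ρ ⟨
    ρ * series (weight 0) 0           ≡⟨ series⁺-zero (weight 0) ⟨
    series⁺ (weight 0) 0              ≡⟨ series-weight-zero 0 ⟨
    closed 1 0                        ∎
    where open ≡-Reasoning
  cdWords-one (suc m) = trans (cong +_ (sum-replicate-zero r)) (sym (closed-suc 1 m))

  cdWords≡closed : ∀ n m → + cdWords n m ≡ closed n m
  cdWords≡closed =
    recurrence-unique cdWords-recurrence closed-recurrence (λ { zero → refl ; (suc m) → refl }) cdWords-one

module Descents {r : ℕ} (c d : Fin r) (c<d : toℕ c < toℕ d) where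

  open CDFactors c d (Fin.<⇒≢ c<d)

  descent-iff-cd : ∀ {n} (a b : Fin n) (ca cb : Fin r) →
    ⌊ ca ≟ c ⌋ ∧ ⌊ cb ≟ d ⌋ ∧ ((b , cb) <ᶜ (a , ca)) ≡ isCD ca cb
  descent-iff-cd a b ca cb with ca ≟ c | cb ≟ d
  ... | no _     | _        = refl
  ... | yes _    | no _     = refl
  ... | yes refl | yes refl =
    cong (_∨ (⌊ d ≟ c ⌋ ∧ ⌊ toℕ b ℕ.<? toℕ a ⌋)) (⌊⌋-true (toℕ c ℕ.<? toℕ d) c<d)

  desList≡cdFactors : ∀ {n k} (w : Vec (Fin n) k) (cs : Vec (Fin r) k) →
    desList c d (toList (zip w cs)) ≡ cdFactors (toList cs)
  desList≡cdFactors [] [] = refl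
  desList≡cdFactors (_ ∷ []) (_ ∷ []) = refl
  desList≡cdFactors (a ∷ b ∷ w) (ca ∷ cb ∷ cs) =
    cong₂ ℕ._+_ (cong (if_then 1 else 0) (descent-iff-cd a b ca cb))
                (desList≡cdFactors (b ∷ w) (cb ∷ cs))

  descents↔ : ∀ n m → Σ (ColPerm r n) (λ π → des c d π ≡ m) ↔
                      (Arrangement n n × Σ (Vec (Fin r) n) (λ cs → cdFactors (toList cs) ≡ m))
  descents↔ n m = mk↔ₛ′
    (λ { (((w , cs) , u) , e) → (w , u) , cs , trans (sym (desList≡cdFactors w cs)) e })
    (λ { ((w , u) , cs , e) → ((w , cs) , u) , trans (desList≡cdFactors w cs) e })
    (λ { ((w , u) , cs , e) → cong (λ e′ → (w , u) , cs , e′) (ℕ.≡-irrelevant _ _) })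
    (λ { (((w , cs) , u) , e) → cong (λ e′ → ((w , cs) , u) , e′) (ℕ.≡-irrelevant _ _) })

open import Data.Integer using (+_)
import Data.Integer as ℤ
import Data.Integer.Properties as ℤ

proposition3 : (r n m : ℕ) → 2 ≤ r → 1 ≤ n → (c d : Fin r) → toℕ c < toℕ d →
    ∃[ N ] ((Σ (ColPerm r n) (λ π → des c d π ≡ m) ↔ Fin N) × (+ N ≡ formula r n m))
proposition3 r n m _ _ c d c<d = n ! ℕ.* cdWords n m , counting , value
  where
  open CDFactors c d (Fin.<⇒≢ c<d) using (cdWords; cdFactors)
  open Descents c d c<d using (descents↔)
  open WordCount c d (Fin.<⇒≢ c<d) using (cdWords≡closed)
  open ClosedForm r using (closed; formula≡closed)
  counting : Σ (ColPerm r n) (λ π → des c d π ≡ m) ↔ Fin (n ! ℕ.* cdWords n m)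
  counting = ↔-trans (descents↔ n m) (↔-trans (arrangement↔ n ×-↔ fibre↔ n _ m) (↔-sym *↔×))
  value : + (n ! ℕ.* cdWords n m) ≡ formula r n m
  value = begin
    + (n ! ℕ.* cdWords n m)           ≡⟨ ℤ.pos-* (n !) (cdWords n m) ⟩
    + (n !) ℤ.* + cdWords n m         ≡⟨ cong (+ (n !) ℤ.*_) (cdWords≡closed n m) ⟩
    + (n !) ℤ.* closed n m            ≡⟨ formula≡closed n m ⟨
    formula r n m                     ∎
    where open ≡-Reasoning
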